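{- Let $L$ be a complete commutative residuated lattice, $X,A,A',A''$ $L$-enriched categories, $R\colon X\to A$, $R'\colon A\to A'$, $R''\colon A'\to A''$ $L$-enriched functors, and $\mu\colon X\to L$ an $L$-enriched functor. If $A$ is reducible to $A'$ along $R'$ with respect to $R$ and $\mu$, and $A'$ is reducible to $A''$ along $R''$ with respect to $R'\circ R$ and $\mu$, then $A$ is reducible to $A''$ along $R''\circ R'$ with respect to $R$ and $\mu$.
   Context: A complete commutative residuated lattice is a complete lattice $(L,\preceq)$ with a commutative monoid $(1,\cdot)$ such that each $p\cdot(-)$ has a right adjoint $p\Rightarrow(-)$: $p\cdot q\preceq r$ iff $q\preceq(p\Rightarrow r)$. An $L$-enriched category $X$ is a set with $X(-,-)\colon X\times X\to L$ satisfying $1\preceq X(x,x)$ and $X(y,z)\cdot X(x,y)\preceq X(x,z)$. An $L$-enriched functor $F\colon X\to Y$ is a function with $X(x,x')\preceq Y(Fx,Fx')$. $L$ is an $L$-enriched category with $L(p,q)=(p\Rightarrow q)$; $L^{X}$ is the set of $L$-enriched functors $X\to L$ with $L^{X}(\mu,\nu)=\bigwedge_x(\mu x\Rightarrow\nu x)$. For an $L$-enriched functor $S\colon X\to B$, $S^{*}\colon L^{B}\to L^{X}$ is $S^{*}\nu=\nu\circ S$; the $L$-enriched upper approximation $\overline{S}\colon L^{X}\to L^{B}$ is the left $L$-enriched adjoint of $S^{*}$ and the lower approximation $\underline{S}$ the right $L$-enriched adjoint (where $F\colon X\to Y$ is left $L$-enriched adjoint to $G\colon Y\to X$ if $Y(Fx,y)=X(x,Gy)$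 for all $x,y$). Given $S\colon X\to B$ and $\mu\in L^{X}$, $B$ is reducible to $B'$ along an $L$-enriched functor $T\colon B\to B'$ (with respect to $S$ and $\mu$) if $T^{*}(\overline{T\circ S}\,\mu)=\overline{S}\mu$ and $T^{*}(\underline{T\circ S}\,\mu)=\underline{S}\mu$. -}

module Defs where

open import Level using (Level; suc; _⊔_) renaming (zero to lzero)
open import Data.Product using (Σ; _,_; proj₁; proj₂; _×_)
open import Relation.Binary.PropositionalEquality using (_≡_)

-- Complete commutative residuated lattices.
-- Completeness: arbitrary meets and joins of families indexed by any
-- type I : Set (all index sets used below live in Set).

record CCRL : Set₁ where
  infix  4 _≼_
  infixl 7 _·_
  infixr 5 _⇒_
  field
    Carrier : Set
    _≼_     : Carrier → Carrier → Set
    ≼-refl    : ∀ {p} → p ≼ p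
    ≼-trans   : ∀ {p q r} → p ≼ q → q ≼ r → p ≼ r
    ≼-antisym : ∀ {p q} → p ≼ q → q ≼ p → p ≡ q
    ⋀ : {I : Set} → (I → Carrier) → Carrier
    ⋀-lower    : {I : Set} (f : I → Carrier) (i : I) → ⋀ f ≼ f i
    ⋀-greatest : {I : Set} (f : I → Carrier) (p : Carrier) →
                 (∀ i → p ≼ f i) → p ≼ ⋀ f
    ⋁ : {I : Set} → (I → Carrier) → Carrier
    ⋁-upper    : {I : Set} (f : I → Carrier) (i : I) → f i ≼ ⋁ f
    ⋁-least    : {I : Set} (f : I → Carrier) (p : Carrier) →
                 (∀ i → f i ≼ p) → ⋁ f ≼ p
    one    : Carrier
    _·_    : Carrier → Carrier → Carrier
    ·-assoc : ∀ p q r → (p · q) · r ≡ p · (q · r)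
    ·-identityˡ : ∀ p → one · p ≡ p
    ·-identityʳ : ∀ p → p · one ≡ p
    ·-comm  : ∀ p q → p · q ≡ q · p
    _⇒_ : Carrier → Carrier → Carrier
    residual-to   : ∀ {p q r} → p · q ≼ r → q ≼ p ⇒ r
    residual-from : ∀ {p q r} → q ≼ p ⇒ r → p · q ≼ r

module _ (L : CCRL) where
  open CCRL L

  record EHom : Set₁ where
    field
      Obj : Set
      hom : Obj → Obj → Carrier

  record ECat : Set₁ where
    field
      Obj : Set
      hom : Obj → Obj → Carrier
      hom-id   : ∀ x → one ≼ hom x x
      hom-comp : ∀ x y z → hom y z · hom x y ≼ hom x z
    toEHom : EHom
    toEHom = record { Obj = Obj ; hom = hom }

  record EFunctor (X Y : EHom) : Set where
    private
      module X = EHom X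
      module Y = EHom Y
    field
      fobj : X.Obj → Y.Obj
      fhom : ∀ x x' → X.hom x x' ≼ Y.hom (fobj x) (fobj x')
  open EFunctor public

  EFun : ECat → ECat → Set
  EFun X Y = EFunctor (ECat.toEHom X) (ECat.toEHom Y)

  _∘F_ : {X Y Z : EHom} → EFunctor Y Z → EFunctor X Y → EFunctor X Z
  fobj (G ∘F F) x = fobj G (fobj F x)
  fhom (_∘F_ {X} {Y} {Z} G F) x x' =
    ≼-trans (fhom F x x') (fhom G (fobj F x) (fobj F x'))

  -- L^X : L-enriched functors X → L (L(p,q) = p ⇒ q), with
  -- L^X(μ,ν) = ⋀_x (μ x ⇒ ν x)
  Pow : ECat → EHom
  EHom.Obj (Pow X) =
    Σ (ECat.Obj X → Carrier) λ μ → ∀ x x' → ECat.hom X x x' ≼ (μ x ⇒ μ x')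
  EHom.hom (Pow X) μ ν = ⋀ {ECat.Obj X} λ x → proj₁ μ x ⇒ proj₁ ν x

  pull : {X B : ECat} → EFun X B → EFunctor (Pow B) (Pow X)
  fobj (pull {X} {B} S) (ν , ν-fun) =
    (λ x → ν (fobj S x)) , λ x x' → ≼-trans (fhom S x x') (ν-fun (fobj S x) (fobj S x'))
  fhom (pull {X} {B} S) (ν , _) (ν' , _) =
    ⋀-greatest _ _ λ x → ⋀-lower (λ b → ν b ⇒ ν' b) (fobj S x)

  IsLeftAdj : {X Y : EHom} → EFunctor X Y → EFunctor Y X → Set
  IsLeftAdj {X} {Y} F G =
    ∀ x y → EHom.hom Y (fobj F x) y ≡ EHom.hom X x (fobj G y)

  IsUpperApprox : {X B : ECat} → EFun X B → EFunctor (Pow X) (Pow B) → Set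
  IsUpperApprox {X} {B} S U = IsLeftAdj {Pow X} {Pow B} U (pull {X} {B} S)

  IsLowerApprox : {X B : ECat} → EFun X B → EFunctor (Pow X) (Pow B) → Set
  IsLowerApprox {X} {B} S D = IsLeftAdj {Pow B} {Pow X} (pull {X} {B} S) D

  _≐_ : {B : ECat} → EHom.Obj (Pow B) → EHom.Obj (Pow B) → Set
  _≐_ {B} ν ν' = ∀ b → proj₁ ν b ≡ proj₁ ν' b

  -- B is reducible to B' along T w.r.t. S and μ:
  --   T^*(upper(T∘S) μ) = upper(S) μ  and  T^*(lower(T∘S) μ) = lower(S) μ,
  -- where upper/lower denote the (unique) adjoints of S^* resp. (T∘S)^*.
  Reducible : {X B B' : ECat} → (T : EFun B B') → (S : EFun X B) →
              EHom.Obj (Pow X) → Set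
  Reducible {X} {B} {B'} T S μ =
    (U : EFunctor (Pow X) (Pow B)) (U' : EFunctor (Pow X) (Pow B')) →
    (D : EFunctor (Pow X) (Pow B)) (D' : EFunctor (Pow X) (Pow B')) →
    IsUpperApprox {X} {B} S U → IsUpperApprox {X} {B'} (T ∘F S) U' →
    IsLowerApprox {X} {B} S D → IsLowerApprox {X} {B'} (T ∘F S) D' →
    (_≐_ {B} (fobj (pull {B} {B'} T) (fobj U' μ)) (fobj U μ)) ×
    (_≐_ {B} (fobj (pull {B} {B'} T) (fobj D' μ)) (fobj D μ))

{-# OPTIONS --safe #-}

-- Reducibility composes by transitivity of equality, once both hypotheses
-- can be instantiated at the middle category A' with respect to R' ∘ R.
-- That needs the upper and lower approximations of R' ∘ R to exist: those
-- of any S : X → B are the enriched left and right Kan extensions along S,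
--   (upper S μ) b = ⋁ₓ μ x · B(S x, b)   and   (lower S μ) b = ⋀ₓ (B(b, S x) ⇒ μ x),
-- and a map of objects satisfying the adjunction equation is automatically
-- an L-enriched functor.

module Submission where

open import Defs
open import Algebra.Bundles using (CommutativeSemigroup)
open import Data.Product using (_,_; _×_; proj₁; proj₂)
open import Relation.Binary.Bundles using (Poset)
open import Relation.Binary.PropositionalEquality
  using (_≡_; refl; sym; trans; cong₂; isEquivalence)
import Algebra.Properties.CommutativeSemigroup as CommutativeSemigroupProperties
import Relation.Binary.Reasoning.PartialOrder as PartialOrderReasoning

module ResiduatedLattice (L : CCRL) where
  open CCRL L

  ≼-reflexive : ∀ {p q} → p ≡ q → p ≼ q
  ≼-reflexive refl = ≼-refl

  poset : Poset _ _ _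
  poset = record
    { Carrier = Carrier ; _≈_ = _≡_ ; _≤_ = _≼_
    ; isPartialOrder = record
      { isPreorder = record
        { isEquivalence = isEquivalence
        ; reflexive = ≼-reflexive
        ; trans = ≼-trans
        }
      ; antisym = ≼-antisym
      }
    }

  ·-commutativeSemigroup : CommutativeSemigroup _ _
  ·-commutativeSemigroup = record
    { Carrier = Carrier ; _≈_ = _≡_ ; _∙_ = _·_
    ; isCommutativeSemigroup = record
      { isSemigroup = record
        { isMagma = record { isEquivalence = isEquivalence ; ∙-cong = cong₂ _·_ }
        ; assoc = ·-assoc
        }
      ; comm = ·-comm
      }
    }

  open PartialOrderReasoning poset public
  open CommutativeSemigroupProperties ·-commutativeSemigroup public

  ⇒-eval : ∀ {p r} → p · (p ⇒ r) ≼ r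
  ⇒-eval = residual-from ≼-refl

  ·-monoʳ : ∀ {p q q'} → q ≼ q' → p · q ≼ p · q'
  ·-monoʳ q≼q' = residual-from (≼-trans q≼q' (residual-to ≼-refl))

  ·-monoˡ : ∀ {p p' q} → p ≼ p' → p · q ≼ p' · q
  ·-monoˡ {p} {p'} {q} p≼p' = begin
    p · q   ≡⟨ ·-comm p q ⟩
    q · p   ≤⟨ ·-monoʳ p≼p' ⟩
    q · p'  ≡⟨ ·-comm q p' ⟩
    p' · q  ∎

  ·-distribʳ-⋁ : ∀ {I : Set} (f : I → Carrier) p → ⋁ f · p ≼ ⋁ (λ i → f i · p)
  ·-distribʳ-⋁ f p = begin
    ⋁ f · p            ≡⟨ ·-comm (⋁ f) p ⟩
    p · ⋁ f            ≤⟨ residual-from (⋁-least f _ λ i →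
                  residual-to (≼-trans (≼-reflexive (·-comm p (f i))) (⋁-upper _ i))) ⟩
    ⋁ (λ i → f i · p)  ∎

  ⋀⇒-intro : ∀ {I : Set} {f g : I → Carrier} {p} →
             (∀ i → f i · p ≼ g i) → p ≼ ⋀ (λ i → f i ⇒ g i)
  ⋀⇒-intro h = ⋀-greatest _ _ λ i → residual-to (h i)

  ⋀⇒-eval : ∀ {I : Set} (f g : I → Carrier) i → f i · ⋀ (λ j → f j ⇒ g j) ≼ g i
  ⋀⇒-eval f g i = ≼-trans (·-monoʳ (⋀-lower _ i)) ⇒-eval

module EnrichedCategories (L : CCRL) where
  open CCRL L
  open ResiduatedLattice L
  open ECat

  hom-compᵒᵖ : (X : ECat L) → ∀ x y z → hom X x y · hom X y z ≼ hom X x z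
  hom-compᵒᵖ X x y z = ≼-trans (≼-reflexive (·-comm _ _)) (hom-comp X x y z)

  Pow-action : (X : ECat L) (ν : EHom.Obj (Pow L X)) →
               ∀ x y → proj₁ ν x · hom X x y ≼ proj₁ ν y
  Pow-action X (ν , ν-fun) x y = residual-from (ν-fun x y)

  -- ECat.toEHom (PowCat X) is Pow L X up to record η, so EFun L (PowCat X) Y
  -- and EFunctor L (Pow L X) (ECat.toEHom Y) are the same type.
  PowCat : ECat L → ECat L
  Obj (PowCat X) = EHom.Obj (Pow L X)
  hom (PowCat X) = EHom.hom (Pow L X)
  hom-id (PowCat X) (μ , _) = ⋀⇒-intro λ x → ≼-reflexive (·-identityʳ (μ x))
  hom-comp (PowCat X) (μ , _) (ν , _) (ρ , _) = ⋀⇒-intro λ x → begin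
    μ x · (k' · k)  ≡⟨ x∙yz≈xz∙y (μ x) k' k ⟩
    (μ x · k) · k'  ≤⟨ ·-monoˡ (⋀⇒-eval μ ν x) ⟩
    ν x · k'        ≤⟨ ⋀⇒-eval ν ρ x ⟩
    ρ x             ∎
    where
    k k' : Carrier
    k  = ⋀ λ y → μ y ⇒ ν y
    k' = ⋀ λ y → ν y ⇒ ρ y

  module _ {X Y : ECat L} where

    leftAdjoint : (G : EFun L Y X) (F : Obj X → Obj Y) →
                  (∀ x y → hom Y (F x) y ≡ hom X x (fobj G y)) → EFun L X Y
    fobj (leftAdjoint G F adj) = F
    fhom (leftAdjoint G F adj) x x' = begin
      hom X x x'                             ≡⟨ ·-identityˡ _ ⟨
      one · hom X x x'                       ≤⟨ ·-monoˡ unit ⟩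
      hom X x' (fobj G (F x')) · hom X x x'  ≤⟨ hom-comp X x x' _ ⟩
      hom X x (fobj G (F x'))                ≡⟨ adj x (F x') ⟨
      hom Y (F x) (F x')                     ∎
      where
      unit : one ≼ hom X x' (fobj G (F x'))
      unit = ≼-trans (hom-id Y (F x')) (≼-reflexive (adj x' (F x')))

    rightAdjoint : (G : EFun L X Y) (F : Obj Y → Obj X) →
                   (∀ x y → hom Y (fobj G x) y ≡ hom X x (F y)) → EFun L Y X
    fobj (rightAdjoint G F adj) = F
    fhom (rightAdjoint G F adj) y y' = begin
      hom Y y y'                           ≡⟨ ·-identityʳ _ ⟨
      hom Y y y' · one                     ≤⟨ ·-monoʳ counit ⟩
      hom Y y y' · hom Y (fobj G (F y)) y  ≤⟨ hom-comp Y _ y y' ⟩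
      hom Y (fobj G (F y)) y'              ≡⟨ adj (F y) y' ⟩
      hom X (F y) (F y')                   ∎
      where
      counit : one ≼ hom Y (fobj G (F y)) y
      counit = ≼-trans (hom-id X (F y)) (≼-reflexive (sym (adj (F y) y)))

module Approximations (L : CCRL) {X B : ECat L} (S : EFun L X B) where
  open CCRL L
  open ResiduatedLattice L
  open EnrichedCategories L
  open ECat

  S* : EFunctor L (Pow L B) (Pow L X)
  S* = pull L {X} {B} S

  upperMap : (Obj X → Carrier) → Obj B → Carrier
  upperMap μ b = ⋁ λ x → μ x · hom B (fobj S x) b

  upperMap-fun : ∀ μ a b → hom B a b ≼ (upperMap μ a ⇒ upperMap μ b)
  upperMap-fun μ a b = residual-to (begin
    upperMap μ a · hom B a b                            ≤⟨ ·-distribʳ-⋁ _ _ ⟩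
    ⋁ (λ x → (μ x · hom B (fobj S x) a) · hom B a b)  ≤⟨ ⋁-least _ _ composite≼ ⟩
    upperMap μ b                                        ∎)
    where
    composite≼ : ∀ x → (μ x · hom B (fobj S x) a) · hom B a b ≼ upperMap μ b
    composite≼ x = begin
      (μ x · hom B (fobj S x) a) · hom B a b  ≡⟨ ·-assoc _ _ _ ⟩
      μ x · (hom B (fobj S x) a · hom B a b)  ≤⟨ ·-monoʳ (hom-compᵒᵖ B _ a b) ⟩
      μ x · hom B (fobj S x) b                ≤⟨ ⋁-upper _ x ⟩
      upperMap μ b                            ∎

  upperMap-unit : ∀ μ x → μ x ≼ upperMap μ (fobj S x)
  upperMap-unit μ x = begin
    μ x                                  ≡⟨ ·-identityʳ (μ x) ⟨
    μ x · one                            ≤⟨ ·-monoʳ (hom-id B (fobj S x)) ⟩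
    μ x · hom B (fobj S x) (fobj S x)    ≤⟨ ⋁-upper _ x ⟩
    upperMap μ (fobj S x)                ∎

  lowerMap : (Obj X → Carrier) → Obj B → Carrier
  lowerMap μ b = ⋀ λ x → hom B b (fobj S x) ⇒ μ x

  lowerMap-fun : ∀ μ a b → hom B a b ≼ (lowerMap μ a ⇒ lowerMap μ b)
  lowerMap-fun μ a b = residual-to (⋀⇒-intro λ x → begin
    hom B b (fobj S x) · (lowerMap μ a · hom B a b)  ≡⟨ x∙yz≈zx∙y _ _ _ ⟩
    (hom B a b · hom B b (fobj S x)) · lowerMap μ a  ≤⟨ ·-monoˡ (hom-compᵒᵖ B a b _) ⟩
    hom B a (fobj S x) · lowerMap μ a                ≤⟨ ⋀⇒-eval _ μ x ⟩
    μ x                                              ∎)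

  lowerMap-counit : ∀ μ x → lowerMap μ (fobj S x) ≼ μ x
  lowerMap-counit μ x = begin
    lowerMap μ (fobj S x)                                ≡⟨ ·-identityˡ _ ⟨
    one · lowerMap μ (fobj S x)                          ≤⟨ ·-monoˡ (hom-id B (fobj S x)) ⟩
    hom B (fobj S x) (fobj S x) · lowerMap μ (fobj S x)  ≤⟨ ⋀⇒-eval _ μ x ⟩
    μ x                                                  ∎

  upperObj : EHom.Obj (Pow L X) → EHom.Obj (Pow L B)
  upperObj (μ , _) = upperMap μ , upperMap-fun μ

  lowerObj : EHom.Obj (Pow L X) → EHom.Obj (Pow L B)
  lowerObj (μ , _) = lowerMap μ , lowerMap-fun μ

  upperObj-adjoint : ∀ μ ν →
    EHom.hom (Pow L B) (upperObj μ) ν ≡ EHom.hom (Pow L X) μ (fobj S* ν)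
  upperObj-adjoint μ@(μ₀ , _) ν@(ν₀ , _) = ≼-antisym
    (⋀⇒-intro λ x → ≼-trans (·-monoˡ (upperMap-unit μ₀ x)) (⋀⇒-eval _ ν₀ (fobj S x)))
    (⋀⇒-intro λ b → ≼-trans (·-distribʳ-⋁ _ _) (⋁-least _ _ λ x → begin
      (μ₀ x · hom B (fobj S x) b) · k     ≡⟨ xy∙z≈xz∙y _ _ _ ⟩
      (μ₀ x · k) · hom B (fobj S x) b     ≤⟨ ·-monoˡ (⋀⇒-eval μ₀ _ x) ⟩
      ν₀ (fobj S x) · hom B (fobj S x) b  ≤⟨ Pow-action B ν _ b ⟩
      ν₀ b                                ∎))
    where
    k : Carrier
    k = EHom.hom (Pow L X) μ (fobj S* ν)

  lowerObj-adjoint : ∀ ν μ →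
    EHom.hom (Pow L X) (fobj S* ν) μ ≡ EHom.hom (Pow L B) ν (lowerObj μ)
  lowerObj-adjoint ν@(ν₀ , _) μ@(μ₀ , _) = ≼-antisym
    (⋀⇒-intro λ b → ⋀⇒-intro λ x → begin
      hom B b (fobj S x) · (ν₀ b · k)  ≡⟨ x∙yz≈yx∙z _ _ _ ⟩
      (ν₀ b · hom B b (fobj S x)) · k  ≤⟨ ·-monoˡ (Pow-action B ν b _) ⟩
      ν₀ (fobj S x) · k                ≤⟨ ⋀⇒-eval _ μ₀ x ⟩
      μ₀ x                             ∎)
    (⋀⇒-intro λ x → ≼-trans (⋀⇒-eval ν₀ _ (fobj S x)) (lowerMap-counit μ₀ x))
    where
    k : Carrier
    k = EHom.hom (Pow L X) (fobj S* ν) μ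

  upper : EFunctor L (Pow L X) (Pow L B)
  upper = leftAdjoint {PowCat X} {PowCat B} S* upperObj upperObj-adjoint

  lower : EFunctor L (Pow L X) (Pow L B)
  lower = rightAdjoint {PowCat B} {PowCat X} S* lowerObj lowerObj-adjoint

  upper-isUpperApprox : IsUpperApprox L {X} {B} S upper
  upper-isUpperApprox = upperObj-adjoint

  lower-isLowerApprox : IsLowerApprox L {X} {B} S lower
  lower-isLowerApprox = lowerObj-adjoint

theorem10 : (L : CCRL) (X A A' A'' : ECat L) →
    (R : EFun L X A) (R' : EFun L A A') (R'' : EFun L A' A'') →
    (μ : EHom.Obj (Pow L X)) →
    Reducible L {X} {A} {A'} R' R μ →
    Reducible L {X} {A'} {A''} R'' (_∘F_ L R' R) μ →
    Reducible L {X} {A} {A''} (_∘F_ L R'' R') R μ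
theorem10 L X A A' A'' R R' R'' μ reducible' reducible'' U U'' D D'' isU isU'' isD isD'' =
  (λ a → trans (proj₁ via-A'' (fobj R' a)) (proj₁ via-A' a)) ,
  (λ a → trans (proj₂ via-A'' (fobj R' a)) (proj₂ via-A' a))
  where
  open Approximations L {X} {A'} (_∘F_ L R' R)

  via-A' : _≐_ L {A} (fobj (pull L {A} {A'} R') (fobj upper μ)) (fobj U μ) ×
           _≐_ L {A} (fobj (pull L {A} {A'} R') (fobj lower μ)) (fobj D μ)
  via-A' = reducible' U upper D lower isU upper-isUpperApprox isD lower-isLowerApprox

  via-A'' : _≐_ L {A'} (fobj (pull L {A'} {A''} R'') (fobj U'' μ)) (fobj upper μ) ×
            _≐_ L {A'} (fobj (pull L {A'} {A''} R'') (fobj D'' μ)) (fobj lower μ)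
  via-A'' = reducible'' upper U'' lower D'' upper-isUpperApprox isU'' lower-isLowerApprox isD''
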